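{- Let $p_1,\ldots,p_n$ be a probability distribution on vertices $1,\ldots,n$, and consider a finite sequence of cop positions (one per round). Suppose the gambler independently in each round occupies vertex $k$ with probability $p_k$. If there are two distinct vertices $i$ and $j$ that the cop occupies in at least two rounds each, and $p_i+p_j\ge 0.732$, then the probability that the gambler evades the cop during the whole sequence (i.e. in no round occupies the same vertex as the cop) is less than $0.162$.
   Context: In the paper the sequence of cop positions is a single depth-first search of a spanning tree (with some extra stays at leaves), and the probability of evasion refers to that single search; the bound applies to any such sequence of positions in which the cop visits $i$ and $j$ at least twice each. -}

module Defs where

open import Data.Nat using (ℕ; zero; suc)
open import Data.Fin using (Fin)
open import Data.Fin.Properties using (_≟_)
open import Data.List using (List; []; _∷_; map; foldr; allFin)
open import Data.Rational using (ℚ; 0ℚ; 1ℚ; _+_; _-_; _*_; _≤_)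
open import Relation.Nullary using (yes; no)
open import Relation.Binary.PropositionalEquality using (_≡_)

sumℚ : List ℚ → ℚ
sumℚ = foldr _+_ 0ℚ

record IsDistribution (n : ℕ) (p : Fin n → ℚ) : Set where
  field
    nonneg : ∀ k → 0ℚ ≤ p k
    total  : sumℚ (map p (allFin n)) ≡ 1ℚ

rounds : {n : ℕ} → Fin n → List (Fin n) → ℕ
rounds v [] = zero
rounds v (c ∷ cs) with v ≟ c
... | yes _ = suc (rounds v cs)
... | no  _ = rounds v cs

-- probability that the gambler, independently in each round occupying
-- vertex k with probability p k, never occupies the cop's vertex:
-- the product over rounds t of (1 - p (cop position at round t))
evasionProb : {n : ℕ} → (Fin n → ℚ) → List (Fin n) → ℚ
evasionProb p [] = 1ℚ
evasionProb p (c ∷ cs) = (1ℚ - p c) * evasionProb p cs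

{-# OPTIONS --safe #-}
-- Each round the cop spends at i (resp. j) multiplies the evasion probability by 1 - pᵢ
-- (resp. 1 - pⱼ), and every other round by a factor in [0, 1]; so two visits to each give
-- the bound ((1 - pᵢ)(1 - pⱼ))². By AM–GM, (1 - pᵢ)(1 - pⱼ) ≤ ((2 - pᵢ - pⱼ) / 2)² ≤ 0.634²,
-- and 0.634⁴ ≈ 0.16157 < 0.162.
module Submission where

open import Defs
open import Algebra.Bundles using (CommutativeMonoid; CommutativeRing)
open import Data.Nat using (ℕ; _≥_; zero; suc; z≤n; s≤s)
import Data.Nat as ℕ
open import Data.Fin using (Fin)
open import Data.Fin.Properties using (_≟_)
open import Data.List using (List; []; _∷_; map; allFin)
open import Data.List.Membership.Propositional using (_∈_)
open import Data.List.Membership.Propositional.Properties using (∈-map⁺; ∈-allFin)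
open import Data.List.Relation.Unary.All using (All; []; _∷_; universal)
open import Data.List.Relation.Unary.All.Properties using (map⁺)
open import Data.List.Relation.Unary.Any using (here; there)
open import Data.Integer using (+_)
open import Data.Rational using (ℚ; _/_; _+_; _-_; _*_; -_; _≤_; _<_; _<?_; 0ℚ; 1ℚ; nonNegative; nonPositive; +-*-rawSemiring)
open import Data.Rational.Properties hiding (_≟_)
open import Data.Rational.Solver using (module +-*-Solver)
open import Data.Sum using (inj₁; inj₂)
open import Relation.Binary.PropositionalEquality using (_≢_; refl; sym)
open import Relation.Nullary using (yes; no; contradiction)
open import Relation.Nullary.Decidable using (from-yes)

open import Algebra.Definitions.RawSemiring +-*-rawSemiring using (_^_)
open import Algebra.Properties.CommutativeSemigroup
  (CommutativeMonoid.commutativeSemigroup *-1-commutativeMonoid) using (x∙yz≈y∙xz)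
open import Algebra.Properties.CommutativeSemiring.Exp
  (CommutativeRing.commutativeSemiring +-*-commutativeRing) using (^-distrib-*)
open +-*-Solver using (solve; _:+_; _:-_; _:*_; _:=_; con)
open ≤-Reasoning

private
  variable
    x y z : ℚ
    m k : ℕ
    xs : List ℚ

*-nonNeg : 0ℚ ≤ x → 0ℚ ≤ y → 0ℚ ≤ x * y
*-nonNeg {x} {y} x≥0 y≥0 =
  nonNegative⁻¹ _ {{nonNeg*nonNeg⇒nonNeg x {{nonNegative x≥0}} y {{nonNegative y≥0}}}}

x*x-nonNeg : ∀ x → 0ℚ ≤ x * x
x*x-nonNeg x with ≤-total 0ℚ x
... | inj₁ x≥0 = *-nonNeg x≥0 x≥0
... | inj₂ x≤0 = nonNegative⁻¹ _ {{nonPos*nonPos⇒nonPos x {{nonPositive x≤0}} x {{nonPositive x≤0}}}}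

*-mono-≤-nonNeg : ∀ {x x′ y y′} → 0ℚ ≤ x → 0ℚ ≤ y′ → x ≤ x′ → y ≤ y′ → x * y ≤ x′ * y′
*-mono-≤-nonNeg {x} {x′} {y} {y′} x≥0 y′≥0 x≤x′ y≤y′ = begin
  x * y   ≤⟨ *-monoˡ-≤-nonNeg x {{nonNegative x≥0}} y≤y′ ⟩
  x * y′  ≤⟨ *-monoʳ-≤-nonNeg y′ {{nonNegative y′≥0}} x≤x′ ⟩
  x′ * y′ ∎

x≤1⇒x*y≤y : x ≤ 1ℚ → 0ℚ ≤ y → x * y ≤ y
x≤1⇒x*y≤y {x} {y} x≤1 y≥0 = begin
  x * y  ≤⟨ *-monoʳ-≤-nonNeg y {{nonNegative y≥0}} x≤1 ⟩
  1ℚ * y ≡⟨ *-identityˡ y ⟩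
  y      ∎

x≤1⇒1-x≥0 : x ≤ 1ℚ → 0ℚ ≤ 1ℚ - x
x≤1⇒1-x≥0 {x} x≤1 = begin
  0ℚ     ≡⟨ sym (+-inverseʳ x) ⟩
  x - x  ≤⟨ +-monoˡ-≤ (- x) x≤1 ⟩
  1ℚ - x ∎

x≥0⇒1-x≤1 : 0ℚ ≤ x → 1ℚ - x ≤ 1ℚ
x≥0⇒1-x≤1 x≥0 = +-monoʳ-≤ 1ℚ (neg-antimono-≤ x≥0)

[1-x]+[1-y]≤2-c : ∀ x y {c} → c ≤ x + y → (1ℚ - x) + (1ℚ - y) ≤ (1ℚ + 1ℚ) - c
[1-x]+[1-y]≤2-c x y {c} c≤x+y = begin
  (1ℚ - x) + (1ℚ - y) ≡⟨ solve 2 (λ x y → (con 1ℚ :- x) :+ (con 1ℚ :- y)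
                                          := (con 1ℚ :+ con 1ℚ) :- (x :+ y)) refl x y ⟩
  (1ℚ + 1ℚ) - (x + y) ≤⟨ +-monoʳ-≤ (1ℚ + 1ℚ) (neg-antimono-≤ c≤x+y) ⟩
  (1ℚ + 1ℚ) - c       ∎

^-nonNeg : 0ℚ ≤ x → ∀ m → 0ℚ ≤ x ^ m
^-nonNeg x≥0 zero    = from-yes (0ℚ ≤? 1ℚ)
^-nonNeg x≥0 (suc m) = *-nonNeg x≥0 (^-nonNeg x≥0 m)

^-antitone : 0ℚ ≤ x → x ≤ 1ℚ → m ℕ.≤ k → x ^ k ≤ x ^ m
^-antitone {k = zero}  x≥0 x≤1 z≤n = ≤-refl
^-antitone {k = suc k} x≥0 x≤1 z≤n =
  ≤-trans (x≤1⇒x*y≤y x≤1 (^-nonNeg x≥0 k)) (^-antitone {k = k} x≥0 x≤1 z≤n)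
^-antitone {x} x≥0 x≤1 (s≤s m≤k) =
  *-monoˡ-≤-nonNeg x {{nonNegative x≥0}} (^-antitone x≥0 x≤1 m≤k)

^-mono-nonNeg : 0ℚ ≤ x → x ≤ y → ∀ m → x ^ m ≤ y ^ m
^-mono-nonNeg x≥0 x≤y zero    = ≤-refl
^-mono-nonNeg x≥0 x≤y (suc m) =
  *-mono-≤-nonNeg x≥0 (^-nonNeg (≤-trans x≥0 x≤y) m) x≤y (^-mono-nonNeg x≥0 x≤y m)

four : ℚ
four = (+ 4) / 1

4xy≤[x+y]² : ∀ x y → four * (x * y) ≤ (x + y) * (x + y)
4xy≤[x+y]² x y = begin
  four * (x * y)                     ≡⟨ sym (+-identityˡ (four * (x * y))) ⟩
  0ℚ + four * (x * y)                ≤⟨ +-monoˡ-≤ (four * (x * y)) (x*x-nonNeg (x - y)) ⟩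
  (x - y) * (x - y) + four * (x * y) ≡⟨ solve 2 (λ x y → (x :- y) :* (x :- y) :+ con four :* (x :* y)
                                                          := (x :+ y) :* (x :+ y)) refl x y ⟩
  (x + y) * (x + y)                  ∎

am-gm : 0ℚ ≤ x → 0ℚ ≤ y → x + y ≤ z + z → x * y ≤ z * z
am-gm {x} {y} {z} x≥0 y≥0 x+y≤2z = *-cancelˡ-≤-pos four (begin
  four * (x * y)    ≤⟨ 4xy≤[x+y]² x y ⟩
  (x + y) * (x + y) ≤⟨ *-mono-≤-nonNeg x+y≥0 (≤-trans x+y≥0 x+y≤2z) x+y≤2z x+y≤2z ⟩
  (z + z) * (z + z) ≡⟨ solve 1 (λ z → (z :+ z) :* (z :+ z) := con four :* (z :* z)) refl z ⟩
  four * (z * z)    ∎)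
  where
  x+y≥0 : 0ℚ ≤ x + y
  x+y≥0 = +-mono-≤ x≥0 y≥0

sumℚ-nonNeg : All (0ℚ ≤_) xs → 0ℚ ≤ sumℚ xs
sumℚ-nonNeg []           = ≤-refl
sumℚ-nonNeg (x≥0 ∷ xs≥0) = +-mono-≤ x≥0 (sumℚ-nonNeg xs≥0)

∈⇒≤sumℚ : All (0ℚ ≤_) xs → x ∈ xs → x ≤ sumℚ xs
∈⇒≤sumℚ {x ∷ xs} (_ ∷ xs≥0) (here refl) = begin
  x            ≡⟨ sym (+-identityʳ x) ⟩
  x + 0ℚ       ≤⟨ +-monoʳ-≤ x (sumℚ-nonNeg xs≥0) ⟩
  x + sumℚ xs  ∎
∈⇒≤sumℚ {y ∷ xs} {x} (y≥0 ∷ xs≥0) (there x∈xs) = begin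
  x            ≤⟨ ∈⇒≤sumℚ xs≥0 x∈xs ⟩
  sumℚ xs      ≡⟨ sym (+-identityˡ (sumℚ xs)) ⟩
  0ℚ + sumℚ xs ≤⟨ +-monoˡ-≤ (sumℚ xs) y≥0 ⟩
  y + sumℚ xs  ∎

module _ {n : ℕ} {p : Fin n → ℚ} where

  distribution-≤1 : IsDistribution n p → ∀ k → p k ≤ 1ℚ
  distribution-≤1 dist k = begin
    p k                      ≤⟨ ∈⇒≤sumℚ (map⁺ (universal nonneg (allFin n))) (∈-map⁺ p (∈-allFin k)) ⟩
    sumℚ (map p (allFin n))  ≡⟨ total ⟩
    1ℚ                       ∎
    where open IsDistribution dist

  evasionProb-nonNeg : (∀ k → p k ≤ 1ℚ) → ∀ cops → 0ℚ ≤ evasionProb p cops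
  evasionProb-nonNeg p≤1 []         = from-yes (0ℚ ≤? 1ℚ)
  evasionProb-nonNeg p≤1 (c ∷ cops) = *-nonNeg (x≤1⇒1-x≥0 (p≤1 c)) (evasionProb-nonNeg p≤1 cops)

module _ {n : ℕ} {p : Fin n → ℚ} (p≥0 : ∀ k → 0ℚ ≤ p k) (p≤1 : ∀ k → p k ≤ 1ℚ)
         {i j : Fin n} (i≢j : i ≢ j) where

  private
    q r : ℚ
    q = 1ℚ - p i
    r = 1ℚ - p j

    q≥0 : 0ℚ ≤ q
    q≥0 = x≤1⇒1-x≥0 (p≤1 i)
    r≥0 : 0ℚ ≤ r
    r≥0 = x≤1⇒1-x≥0 (p≤1 j)

  evasionProb-≤-rounds : ∀ cops → evasionProb p cops ≤ q ^ rounds i cops * r ^ rounds j cops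
  evasionProb-≤-rounds [] = ≤-reflexive (sym (*-identityˡ 1ℚ))
  evasionProb-≤-rounds (c ∷ cops) with i ≟ c | j ≟ c
  ... | yes refl | yes refl = contradiction refl i≢j
  ... | yes refl | no _ = begin
    q * evasionProb p cops                      ≤⟨ *-monoˡ-≤-nonNeg q {{nonNegative q≥0}} (evasionProb-≤-rounds cops) ⟩
    q * (q ^ rounds i cops * r ^ rounds j cops) ≡⟨ sym (*-assoc q (q ^ rounds i cops) (r ^ rounds j cops)) ⟩
    q * q ^ rounds i cops * r ^ rounds j cops   ∎
  ... | no _ | yes refl = begin
    r * evasionProb p cops                      ≤⟨ *-monoˡ-≤-nonNeg r {{nonNegative r≥0}} (evasionProb-≤-rounds cops) ⟩
    r * (q ^ rounds i cops * r ^ rounds j cops) ≡⟨ x∙yz≈y∙xz r (q ^ rounds i cops) (r ^ rounds j cops) ⟩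
    q ^ rounds i cops * (r * r ^ rounds j cops) ∎
  ... | no _ | no _ = ≤-trans
    (x≤1⇒x*y≤y (x≥0⇒1-x≤1 (p≥0 c)) (evasionProb-nonNeg p≤1 cops))
    (evasionProb-≤-rounds cops)

  evasionProb-≤-visits : ∀ cops → m ℕ.≤ rounds i cops → m ℕ.≤ rounds j cops →
                         evasionProb p cops ≤ (q * r) ^ m
  evasionProb-≤-visits {m} cops i-visited j-visited = begin
    evasionProb p cops                    ≤⟨ evasionProb-≤-rounds cops ⟩
    q ^ rounds i cops * r ^ rounds j cops ≤⟨ *-mono-≤-nonNeg (^-nonNeg q≥0 (rounds i cops)) (^-nonNeg r≥0 m)
                                               (^-antitone q≥0 (x≥0⇒1-x≤1 (p≥0 i)) i-visited)
                                               (^-antitone r≥0 (x≥0⇒1-x≤1 (p≥0 j)) j-visited) ⟩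
    q ^ m * r ^ m                         ≡⟨ sym (^-distrib-* q r m) ⟩
    (q * r) ^ m                           ∎

lemma1 : (n : ℕ) (p : Fin n → ℚ) → IsDistribution n p →
         (cops : List (Fin n)) (i j : Fin n) → i ≢ j →
         rounds i cops ≥ 2 → rounds j cops ≥ 2 →
         (+ 732) / 1000 ≤ p i + p j →
         evasionProb p cops < (+ 162) / 1000
lemma1 n p dist cops i j i≢j i-twice j-twice pᵢ+pⱼ≥c = begin-strict
  evasionProb p cops ≤⟨ evasionProb-≤-visits nonneg p≤1 i≢j cops i-twice j-twice ⟩
  (q * r) ^ 2        ≤⟨ ^-mono-nonNeg (*-nonNeg q≥0 r≥0)
                          (am-gm {z = s} q≥0 r≥0 ([1-x]+[1-y]≤2-c (p i) (p j) pᵢ+pⱼ≥c)) 2 ⟩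
  (s * s) ^ 2        <⟨ from-yes ((s * s) ^ 2 <? (+ 162) / 1000) ⟩
  (+ 162) / 1000     ∎
  where
  open IsDistribution dist using (nonneg)
  p≤1 : ∀ k → p k ≤ 1ℚ
  p≤1 = distribution-≤1 dist
  q r s : ℚ
  q = 1ℚ - p i
  r = 1ℚ - p j
  s = (+ 634) / 1000
  q≥0 : 0ℚ ≤ q
  q≥0 = x≤1⇒1-x≥0 (p≤1 i)
  r≥0 : 0ℚ ≤ r
  r≥0 = x≤1⇒1-x≥0 (p≤1 j)
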